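{- Let $\mathcal{P}_S,\mathcal{P}_T$ be sets of source and target terms, $[\![\cdot]\!]:\mathcal{P}_S\to\mathcal{P}_T$ an encoding, and $\mathcal{R}_S\subseteq\mathcal{P}_S^2$, $\mathcal{R}_T\subseteq\mathcal{P}_T^2$ preorders. Then $[\![\cdot]\!]$ is fully abstract with respect to $\mathcal{R}_S$ and $\mathcal{R}_T$ if and only if there exists a relation $\mathcal{R}\subseteq(\mathcal{P}_S\uplus\mathcal{P}_T)^2$ such that $(S,[\![S]\!])\in\mathcal{R}$ and $([\![S]\!],S)\in\mathcal{R}$ for all $S\in\mathcal{P}_S$, $\mathcal{R}_S=\mathcal{R}|_{\mathcal{P}_S}$, $\mathcal{R}_T=\mathcal{R}|_{\mathcal{P}_T}$, and $\mathcal{R}$ is transitive.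
   Context: The encoding is fully abstract w.r.t. $\mathcal{R}_S$ and $\mathcal{R}_T$ if for all $S_1,S_2\in\mathcal{P}_S$: $(S_1,S_2)\in\mathcal{R}_S$ iff $([\![S_1]\!],[\![S_2]\!])\in\mathcal{R}_T$. For a relation $\mathcal{R}\subseteq B^2$ and $B'\subseteq B$, $\mathcal{R}|_{B'}=\{(x,y)\mid x,y\in B',(x,y)\in\mathcal{R}\}$. -}

module Defs where

open import Level using (Level; _⊔_)
open import Data.Sum using (_⊎_; inj₁; inj₂)
open import Data.Product using (_×_)
open import Relation.Binary.Core using (Rel; _⇒_)
open import Relation.Binary.Definitions using (Transitive)

_≐_ : ∀ {a ℓ₁ ℓ₂} {A : Set a} → Rel A ℓ₁ → Rel A ℓ₂ → Set _
R₁ ≐ R₂ = (R₁ ⇒ R₂) × (R₂ ⇒ R₁)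

restrictS : ∀ {a b ℓ} {PS : Set a} {PT : Set b} → Rel (PS ⊎ PT) ℓ → Rel PS ℓ
restrictS R x y = R (inj₁ x) (inj₁ y)

restrictT : ∀ {a b ℓ} {PS : Set a} {PT : Set b} → Rel (PS ⊎ PT) ℓ → Rel PT ℓ
restrictT R x y = R (inj₂ x) (inj₂ y)

FullyAbstract : ∀ {a b ℓ₁ ℓ₂} {PS : Set a} {PT : Set b} →
  (PS → PT) → Rel PS ℓ₁ → Rel PT ℓ₂ → Set _
FullyAbstract {PS = PS} enc RS RT =
  ∀ (S₁ S₂ : PS) → (RS S₁ S₂ → RT (enc S₁) (enc S₂)) × (RT (enc S₁) (enc S₂) → RS S₁ S₂)

-- If R is transitive and relates each S with [[S]] both ways, then any R-step between
-- sources can be routed through their encodings and back, and vice versa; this gives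
-- full abstraction. Conversely, given full abstraction, comparing terms through their
-- images in the target (a source S standing for [[S]]) yields such an R.
module Submission where

open import Defs
open import Level using (_⊔_; Lift; lift; lower)
open import Data.Sum using (_⊎_; inj₁; inj₂; [_,_])
open import Data.Product using (_×_; Σ; _,_; proj₁; proj₂)
open import Function using (id)
open import Relation.Binary.Core using (Rel)
open import Relation.Binary.Structures using (IsPreorder)
open import Relation.Binary.PropositionalEquality using (_≡_)
open import Relation.Binary.Definitions using (Transitive)

module _ {a b ℓ₁ ℓ₂} {PS : Set a} {PT : Set b}
         (enc : PS → PT) (RS : Rel PS ℓ₁) (RT : Rel PT ℓ₂) where

  RelatesEncodings : ∀ {ℓ} → Rel (PS ⊎ PT) ℓ → Set (a ⊔ ℓ)
  RelatesEncodings R = ∀ S → R (inj₁ S) (inj₂ (enc S)) × R (inj₂ (enc S)) (inj₁ S)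

  IsCombinedRelation : ∀ {ℓ} → Rel (PS ⊎ PT) ℓ → Set _
  IsCombinedRelation R =
    RelatesEncodings R × (RS ≐ restrictS R) × (RT ≐ restrictT R) × Transitive R

  combined⇒fullyAbstract : ∀ {ℓ} (R : Rel (PS ⊎ PT) ℓ) →
    IsCombinedRelation R → FullyAbstract enc RS RT
  combined⇒fullyAbstract R (encR , (RS⇒R , R⇒RS) , (RT⇒R , R⇒RT) , trans) S₁ S₂ =
    (λ r → R⇒RT (trans (proj₂ (encR S₁)) (trans (RS⇒R r) (proj₁ (encR S₂)))))
    , (λ r → R⇒RS (trans (proj₁ (encR S₁)) (trans (RT⇒R r) (proj₂ (encR S₂)))))

  viaTarget : Rel (PS ⊎ PT) (a ⊔ ℓ₂)
  viaTarget x y = Lift a (RT ([ enc , id ] x) ([ enc , id ] y))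

  fullyAbstract⇒viaTarget-combined : IsPreorder _≡_ RT →
    FullyAbstract enc RS RT → IsCombinedRelation viaTarget
  fullyAbstract⇒viaTarget-combined preorder fa =
    (λ S → lift refl , lift refl)
    , ((λ {S₁} {S₂} r → lift (proj₁ (fa S₁ S₂) r)) , (λ {S₁} {S₂} r → proj₂ (fa S₁ S₂) (lower r)))
    , (lift , lower)
    , (λ r s → lift (trans (lower r) (lower s)))
    where open IsPreorder preorder using (refl; trans)

lemma5 : ∀ {a ℓ} {PS PT : Set a} (enc : PS → PT) (RS : Rel PS ℓ) (RT : Rel PT ℓ) →
    IsPreorder _≡_ RS → IsPreorder _≡_ RT →
    (FullyAbstract enc RS RT →
       Σ (Rel (PS ⊎ PT) (a ⊔ ℓ)) λ R → ((∀ S → R (inj₁ S) (inj₂ (enc S)) × R (inj₂ (enc S)) (inj₁ S))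
               × (RS ≐ restrictS R) × (RT ≐ restrictT R) × Transitive R))
    × ((Σ (Rel (PS ⊎ PT) (a ⊔ ℓ)) λ R → ((∀ S → R (inj₁ S) (inj₂ (enc S)) × R (inj₂ (enc S)) (inj₁ S))
               × (RS ≐ restrictS R) × (RT ≐ restrictT R) × Transitive R))
       → FullyAbstract enc RS RT)
lemma5 enc RS RT _ RT-preorder =
  (λ fa → viaTarget enc RS RT , fullyAbstract⇒viaTarget-combined enc RS RT RT-preorder fa)
  , (λ (R , combined) → combined⇒fullyAbstract enc RS RT R combined)
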